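{- Let $T$ be a tree with root $r$ and edge weights $w:E(T)\to\mathbb{N}$. Let $P_1,\dots,P_t$ be an $r$-maximal (weighted) path partition of $T$, indexed so that $w(P_1)\ge w(P_2)\ge\cdots\ge w(P_t)$, and set $f_k^w(T,r)=k\,w(P_1)+\sum_{i=2}^t w(P_i)-t+1$. Then for every positive integer $k$, $\pi_k^w(T,r)\le f_k^w(T,r)$.
   Context: A configuration on $T$ assigns a nonnegative integer number of pebbles to each vertex; its size is the total number of pebbles. A $w$-weighted pebbling move along an edge $e=uv$ removes $w_e=w(e)$ pebbles from one endpoint and places one pebble on the other endpoint. $\pi_k^w(T,r)$ is the minimum $m$ such that from every configuration of size $m$ one can, using $w$-weighted pebbling moves, obtain at least $k$ pebbles on $r$. The weight $w(P)$ of a path $P$ is the product of the weights of its edges. An $r$-path partition of $T$ is a partition of $E(T)$ into paths $P_1,\dots,P_t$ obtained from a sequence of pairs $(T_i,F_i)$, $i=0,\dots,t$ (each $T_i$ a tree, each $F_i$ a forest, $E(T_i)\cup E(F_i)=E(T)$, $E(T_i)\cap E(F_i)=\emptyset$), with $T_0$ the single vertex $r$, $F_0=T$, $T_t=T$, $F_t$ edgeless, such that $T_i=T_{i-1}\cup P_i$, $F_i$ is $F_{i-1}$ minus the edges of $P_i$, and $V(P_i)\cap V(T_{i-1})$ is a single vertex which is an endpoint of $P_i$. The partition is $r$-maximal (weighted version) if at each step $P_i$ is a path of greatest weight among all paths in $F_{i-1}$ meeting $T_{i-1}$ in exactly one vertex which is an endpoint of the path. -}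

module Defs where

open import Data.Nat using (ℕ; zero; suc; _+_; _*_; _∸_; _≤_)
open import Data.Fin using (Fin; _≟_) renaming (zero to fzero; suc to fsuc)
open import Data.Bool using (Bool; true; false; if_then_else_)
open import Data.Product using (Σ; _×_; _,_; proj₁; proj₂; ∃)
open import Data.Sum using (_⊎_)
open import Data.Unit using (⊤)
open import Data.List using (List; []; _∷_; map; concatMap; length; _++_; [_])
open import Data.Nat.ListAction using (product; sum)
open import Data.List.Membership.Propositional using (_∈_; _∉_)
open import Data.List.Relation.Unary.All using (All)
open import Data.List.Relation.Unary.Unique.Propositional using (Unique)
open import Relation.Binary.PropositionalEquality using (_≡_)
open import Relation.Binary.Construct.Closure.ReflexiveTransitive using (Star)
open import Relation.Nullary using (¬_; does)

module _ {n m : ℕ} (ends : Fin m → Fin n × Fin n) where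

  Joins : Fin m → Fin n → Fin n → Set
  Joins e a b = (ends e ≡ (a , b)) ⊎ (ends e ≡ (b , a))

  Adj : Fin n → Fin n → Set
  Adj a b = ∃ λ e → Joins e a b

  IsTree : Set
  IsTree = (suc m ≡ n) × (∀ (a b : Fin n) → Star Adj a b)

  -- a path: start vertex v0 and steps (e1,v1),…,(eℓ,vℓ), eᵢ joins vᵢ₋₁ and vᵢ
  ValidSteps : Fin n → List (Fin m × Fin n) → Set
  ValidSteps a [] = ⊤
  ValidSteps a ((e , b) ∷ s) = Joins e a b × ValidSteps b s

  lastV : Fin n → List (Fin m × Fin n) → Fin n
  lastV a [] = a
  lastV a ((e , b) ∷ s) = lastV b s

  record Path : Set where
    constructor mkPath
    field
      start    : Fin n
      steps    : List (Fin m × Fin n)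
      nonempty : ¬ (steps ≡ [])
      valid    : ValidSteps start steps
      distinct : Unique (start ∷ map proj₂ steps)

  pverts : Path → List (Fin n)
  pverts p = Path.start p ∷ map proj₂ (Path.steps p)

  pedges : Path → List (Fin m)
  pedges p = map proj₁ (Path.steps p)

  pend : Path → Fin n
  pend p = lastV (Path.start p) (Path.steps p)

  treeVerts : Fin n → List Path → List (Fin n)
  treeVerts r ps = r ∷ concatMap pverts ps

  usedEdges : List Path → List (Fin m)
  usedEdges ps = concatMap pedges ps

  MeetsAtEndpoint : List (Fin n) → Path → Set
  MeetsAtEndpoint V p =
    Σ (Fin n) λ v → ((v ≡ Path.start p) ⊎ (v ≡ pend p)) × v ∈ V
      × (∀ x → x ∈ pverts p → x ∈ V → x ≡ v)

  Candidate : Fin n → List Path → Path → Set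
  Candidate r prev p = All (λ e → e ∉ usedEdges prev) (pedges p)
                       × MeetsAtEndpoint (treeVerts r prev) p

  module _ (w : Fin m → ℕ) where

    weight : Path → ℕ
    weight p = product (map w (pedges p))

    -- MaxPartFrom r prev ps : having already chosen prev = P_1,…,P_{i-1},
    -- the list ps = P_i,…,P_t continues it to an r-maximal r-path partition
    data MaxPartFrom (r : Fin n) (prev : List Path) : List Path → Set where
      done : (∀ e → e ∈ usedEdges prev) → MaxPartFrom r prev []
      step : ∀ {p ps} → Candidate r prev p
           → (∀ q → Candidate r prev q → weight q ≤ weight p)
           → MaxPartFrom r (prev ++ [ p ]) ps
           → MaxPartFrom r prev (p ∷ ps)

    RMaxPartition : Fin n → List Path → Set
    RMaxPartition r ps = MaxPartFrom r [] ps

    Config : Set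
    Config = Fin n → ℕ

    size : ∀ {k} → (Fin k → ℕ) → ℕ
    size {zero} C = 0
    size {suc k} C = C fzero + size (λ i → C (fsuc i))

    src : Fin m → Bool → Fin n
    src e true = proj₁ (ends e)
    src e false = proj₂ (ends e)

    dst : Fin m → Bool → Fin n
    dst e true = proj₂ (ends e)
    dst e false = proj₁ (ends e)

    applyMove : Config → Fin m → Bool → Config
    applyMove C e d x =
      (C x ∸ (if does (x ≟ src e d) then w e else 0))
        + (if does (x ≟ dst e d) then 1 else 0)

    data Step (C : Config) : Config → Set where
      move : (e : Fin m) (d : Bool) → w e ≤ C (src e d) → Step C (applyMove C e d)

    Reaches : Config → Config → Set
    Reaches = Star Step

    Solvable : ℕ → Fin n → Config → Set
    Solvable k r C = Σ Config λ D → Reaches C D × (k ≤ D r)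

    -- π_k^w(T,r) ≤ b : since π is the minimum M such that every configuration of
    -- size M is solvable, this says some M ≤ b has that property
    PebblingBoundLE : ℕ → Fin n → ℕ → Set
    PebblingBoundLE k r b =
      Σ ℕ λ M → M ≤ b × (∀ (C : Config) → size C ≡ M → Solvable k r C)

    fkw : ℕ → Path → List Path → ℕ
    fkw k q qs = (k * weight q + sum (map weight qs) + 1) ∸ length (q ∷ qs)

module Submission where

-- Give every vertex x of the growing tree a coefficient c_x ≥ 1 bounding the weight of
-- every path that can still be attached at x, starting with c_r = w(P₁), and read
-- Σ_x c_x·C(x) as the value of a configuration C. When P_i is attached at y, its
-- vertex x gets as coefficient the weight of the part of P_i beyond x: anything
-- hanging from x, prefixed by the part of P_i up to x, was a candidate when P_i was
-- chosen, so maximality keeps the bound. Pushing all pebbles of P_i onto y (last path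
-- first) converts value at the rate given by the coefficients and loses less than
-- w(P_i) to remainders. Hence |C| + t ≤ w(P₁)·C′(r) + Σ w(P_i) for a reachable C′,
-- which for |C| = f_k^w(T,r) forces C′(r) ≥ k.

open import Defs
open import Data.Bool using (true; false)
open import Data.Empty using (⊥-elim)
open import Data.Fin using (Fin; _≟_)
import Data.Fin as Fin
open import Data.List using (List; []; _∷_; map; _++_; [_]; reverse; _ʳ++_; concatMap; length; tabulate; allFin)
open import Data.List.Properties using (map-++; ++-conicalʳ; map-tabulate)
open import Data.List.Membership.Propositional using (_∈_; _∉_; find; lose)
open import Data.List.Membership.Propositional.Properties
  using (∈-++⁺ˡ; ∈-++⁺ʳ; ∈-++⁻; ∈-map⁺; ∈-∃++; ∈-concatMap⁺; ∈-concatMap⁻)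
open import Data.List.Relation.Binary.Disjoint.Propositional using (Disjoint)
open import Data.List.Relation.Binary.Permutation.Propositional using (_↭_; ↭-refl; ↭-sym; ↭⇒↭ₛ)
open import Data.List.Relation.Binary.Permutation.Propositional.Properties
  using (↭-reverse; ∈-resp-↭; ↭-length; ¬x∷xs↭[])
import Data.List.Relation.Binary.Permutation.Propositional.Properties as Perm
open import Data.List.Relation.Binary.Permutation.Setoid.Properties using (Unique-resp-↭)
open import Data.List.Relation.Binary.Subset.Propositional.Properties using (xs⊆xs++ys)
open import Data.List.Relation.Unary.All using (All)
import Data.List.Relation.Unary.All as All
import Data.List.Relation.Unary.All.Properties as All
open import Data.List.Relation.Unary.AllPairs using ([]; _∷_)
import Data.List.Relation.Unary.AllPairs as AllPairs
open import Data.List.Relation.Unary.Any using (here; there)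
import Data.List.Relation.Unary.Any.Properties as Any
open import Data.List.Relation.Unary.Linked using (Linked)
open import Data.List.Relation.Unary.Linked.Properties using (Linked⇒All)
open import Data.List.Relation.Unary.Unique.Propositional using (Unique)
import Data.List.Relation.Unary.Unique.Propositional.Properties as Unique
open import Data.Nat using (ℕ; zero; suc; _+_; _*_; _∸_; _≤_; _<_; z≤n; s≤s; NonZero; >-nonZero)
open import Data.Nat.DivMod using (_/_; _%_; m≡m%n+[m/n]*n; m%n<n; m/n*n≤m)
open import Data.Nat.ListAction using (product; sum)
open import Data.Nat.ListAction.Properties using (product-↭; product-++; sum-↭; sum-++)
open import Data.Nat.Properties hiding (_≟_)
open import Algebra.Properties.CommutativeSemigroup +-commutativeSemigroup using (xy∙z≈xz∙y; x∙yz≈xz∙y; x∙yz≈yx∙z)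
open import Data.Product using (∃; ∃₂; _×_; _,_; proj₁; proj₂)
open import Data.Sum using (_⊎_; inj₁; inj₂)
import Data.Sum as Sum
open import Data.Unit using (tt)
open import Function using (id; _∘_)
open import Relation.Binary.Construct.Closure.ReflexiveTransitive using (Star; ε; _◅_; _◅◅_)
open import Relation.Binary.PropositionalEquality
  using (_≡_; _≢_; refl; sym; trans; cong; cong₂; subst; setoid; module ≡-Reasoning)
open import Relation.Nullary using (yes; no)
open import Relation.Nullary.Decidable using (dec-true; dec-false)

m<[1+m/n]*n : ∀ m n .{{_ : NonZero n}} → m < suc (m / n) * n
m<[1+m/n]*n m n = begin-strict
  m                 ≡⟨ m≡m%n+[m/n]*n m n ⟩
  m % n + m / n * n <⟨ +-monoˡ-< (m / n * n) (m%n<n m n) ⟩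
  n + m / n * n     ∎
  where open ≤-Reasoning

m*a+s<[1+n]*a+s⇒m≤n : ∀ m n a s → m * a + s < suc n * a + s → m ≤ n
m*a+s<[1+n]*a+s⇒m≤n m n a s lt = m<1+n⇒m≤n (*-cancelʳ-< a m (suc n) (+-cancelʳ-< s (m * a) (suc n * a) lt))

Unique-reverse : ∀ {A : Set} {xs : List A} → Unique xs → Unique (reverse xs)
Unique-reverse {xs = xs} = Unique-resp-↭ (setoid _) (↭⇒↭ₛ (↭-sym (↭-reverse xs)))

Unique-++⁻ˡ : ∀ {A : Set} (xs : List A) {ys} → Unique (xs ++ ys) → Unique xs
Unique-++⁻ˡ []       _           = []
Unique-++⁻ˡ (x ∷ xs) (x∉ ∷ uniq) = All.++⁻ˡ xs x∉ ∷ Unique-++⁻ˡ xs uniq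

module _ {A B : Set} (f : A → List B) {y : B} where

  ∈-concatMap-++⁺ˡ : ∀ xs ys → y ∈ concatMap f xs → y ∈ concatMap f (xs ++ ys)
  ∈-concatMap-++⁺ˡ xs ys = ∈-concatMap⁺ f {xs ++ ys} ∘ Any.++⁺ˡ ∘ ∈-concatMap⁻ f {xs}

  ∈-concatMap-++⁺ʳ : ∀ xs {ys} → y ∈ concatMap f ys → y ∈ concatMap f (xs ++ ys)
  ∈-concatMap-++⁺ʳ xs {ys} = ∈-concatMap⁺ f {xs ++ ys} ∘ Any.++⁺ʳ xs ∘ ∈-concatMap⁻ f {ys}

  ∈-concatMap-++⁻ : ∀ xs {ys} → y ∈ concatMap f (xs ++ ys) → y ∈ concatMap f xs ⊎ y ∈ concatMap f ys
  ∈-concatMap-++⁻ xs {ys} = Sum.map (∈-concatMap⁺ f {xs}) (∈-concatMap⁺ f {ys}) ∘ Any.++⁻ xs ∘ ∈-concatMap⁻ f {xs ++ ys}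

module _ {n m : ℕ} (ends : Fin m → Fin n × Fin n) where

  open Path

  Steps : Set
  Steps = List (Fin m × Fin n)

  joins-sym : ∀ {e a b} → Joins ends e a b → Joins ends e b a
  joins-sym (inj₁ eq) = inj₂ eq
  joins-sym (inj₂ eq) = inj₁ eq

  joins-endpoint : ∀ {e a b x y} → Joins ends e a b → Joins ends e x y → y ≡ a ⊎ y ≡ b
  joins-endpoint (inj₁ p) (inj₁ q) = inj₂ (trans (sym (cong proj₂ q)) (cong proj₂ p))
  joins-endpoint (inj₁ p) (inj₂ q) = inj₁ (trans (sym (cong proj₁ q)) (cong proj₁ p))
  joins-endpoint (inj₂ p) (inj₁ q) = inj₁ (trans (sym (cong proj₂ q)) (cong proj₂ p))
  joins-endpoint (inj₂ p) (inj₂ q) = inj₂ (trans (sym (cong proj₁ q)) (cong proj₁ p))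

  edge-endpoint-on-steps : ∀ a s {e x y} → ValidSteps ends a s → e ∈ map proj₁ s → Joins ends e x y →
                           y ∈ a ∷ map proj₂ s
  edge-endpoint-on-steps a ((_ , b) ∷ s) (j , _) (here refl) J with joins-endpoint j J
  ... | inj₁ y≡a = here y≡a
  ... | inj₂ y≡b = there (here y≡b)
  edge-endpoint-on-steps a ((_ , b) ∷ s) (_ , v) (there i) J = there (edge-endpoint-on-steps b s v i J)

  ValidSteps-++⁻ˡ : ∀ a s t → ValidSteps ends a (s ++ t) → ValidSteps ends a s
  ValidSteps-++⁻ˡ a []            t _       = tt
  ValidSteps-++⁻ˡ a ((e , b) ∷ s) t (j , v) = j , ValidSteps-++⁻ˡ b s t v

  ValidSteps-++⁺ : ∀ a s t → ValidSteps ends a s → ValidSteps ends (lastV ends a s) t → ValidSteps ends a (s ++ t)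
  ValidSteps-++⁺ a []            t _       vt = vt
  ValidSteps-++⁺ a ((e , b) ∷ s) t (j , v) vt = j , ValidSteps-++⁺ b s t v vt

  reverseOnto : Fin n → Steps → Steps → Steps
  reverseOnto a []            acc = acc
  reverseOnto a ((e , b) ∷ s) acc = reverseOnto b s ((e , a) ∷ acc)

  reverseOnto-valid : ∀ a s acc → ValidSteps ends a s → ValidSteps ends a acc →
                      ValidSteps ends (lastV ends a s) (reverseOnto a s acc)
  reverseOnto-valid a []            acc _       va = va
  reverseOnto-valid a ((e , b) ∷ s) acc (j , v) va = reverseOnto-valid b s _ v (joins-sym j , va)

  reverseOnto-vertices : ∀ a s acc →
    lastV ends a s ∷ map proj₂ (reverseOnto a s acc) ≡ (a ∷ map proj₂ s) ʳ++ map proj₂ acc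
  reverseOnto-vertices a []            acc = refl
  reverseOnto-vertices a ((e , b) ∷ s) acc = reverseOnto-vertices b s ((e , a) ∷ acc)

  reverseOnto-edges : ∀ a s acc → map proj₁ (reverseOnto a s acc) ≡ map proj₁ s ʳ++ map proj₁ acc
  reverseOnto-edges a []            acc = refl
  reverseOnto-edges a ((e , b) ∷ s) acc = reverseOnto-edges b s ((e , a) ∷ acc)

  reverseOnto≡[] : ∀ a s acc → reverseOnto a s acc ≡ [] → s ≡ [] × acc ≡ []
  reverseOnto≡[] a []            acc eq = refl , eq
  reverseOnto≡[] a ((e , b) ∷ s) acc eq with reverseOnto≡[] b s _ eq
  ... | _ , ()

  reversePath : Path ends → Path ends
  reversePath p = mkPath (pend ends p) (reverseOnto (start p) (steps p) [])
    (nonempty p ∘ proj₁ ∘ reverseOnto≡[] (start p) (steps p) [])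
    (reverseOnto-valid (start p) (steps p) [] (valid p) tt)
    (subst Unique (sym (reverseOnto-vertices (start p) (steps p) [])) (Unique-reverse (distinct p)))

  record Orientation (p : Path ends) (v : Fin n) : Set where
    field
      path        : Path ends
      starts-at   : start path ≡ v
      vertices-↭  : pverts ends path ↭ pverts ends p
      edges-↭     : pedges ends path ↭ pedges ends p

  orientFrom : ∀ {v} (p : Path ends) → v ≡ start p ⊎ v ≡ pend ends p → Orientation p v
  orientFrom p (inj₁ v≡start) = record
    { path = p ; starts-at = sym v≡start ; vertices-↭ = ↭-refl ; edges-↭ = ↭-refl }
  orientFrom p (inj₂ v≡end) = record
    { path       = reversePath p
    ; starts-at  = sym v≡end
    ; vertices-↭ = subst (_↭ pverts ends p) (sym (reverseOnto-vertices (start p) (steps p) [])) (↭-reverse (pverts ends p))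
    ; edges-↭    = subst (_↭ pedges ends p) (sym (reverseOnto-edges (start p) (steps p) [])) (↭-reverse (pedges ends p))
    }

  graft : ∀ a s (q : Path ends) → ValidSteps ends a s → Unique (a ∷ map proj₂ s) → start q ≡ lastV ends a s →
          Disjoint (a ∷ map proj₂ s) (map proj₂ (steps q)) → Path ends
  graft a s q vs us q-start disjoint = mkPath a (s ++ steps q)
    (nonempty q ∘ ++-conicalʳ s (steps q))
    (ValidSteps-++⁺ a s (steps q) vs (subst (λ x → ValidSteps ends x (steps q)) q-start (valid q)))
    (subst (λ l → Unique (a ∷ l)) (sym (map-++ proj₂ s (steps q))) (Unique.++⁺ us (AllPairs.tail (distinct q)) disjoint))

  module _ (w : Fin m → ℕ) (w≥1 : ∀ e → 1 ≤ w e) where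

    private instance
      w-nonZero : ∀ {e} → NonZero (w e)
      w-nonZero {e} = >-nonZero (w≥1 e)

    Cfg : Set
    Cfg = Config ends w

    stepsWeight : Steps → ℕ
    stepsWeight s = product (map w (map proj₁ s))

    stepsWeight≥1 : ∀ s → 1 ≤ stepsWeight s
    stepsWeight≥1 []            = s≤s z≤n
    stepsWeight≥1 ((e , _) ∷ s) = *-mono-≤ (w≥1 e) (stepsWeight≥1 s)

    stepsWeight-++ : ∀ s t → stepsWeight (s ++ t) ≡ stepsWeight s * stepsWeight t
    stepsWeight-++ s t = begin
      product (map w (map proj₁ (s ++ t)))                  ≡⟨ cong (product ∘ map w) (map-++ proj₁ s t) ⟩
      product (map w (map proj₁ s ++ map proj₁ t))          ≡⟨ cong product (map-++ w (map proj₁ s) _) ⟩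
      product (map w (map proj₁ s) ++ map w (map proj₁ t))  ≡⟨ product-++ (map w (map proj₁ s)) _ ⟩
      stepsWeight s * stepsWeight t                         ∎
      where open ≡-Reasoning

    weight-↭ : ∀ {o p} → pedges ends o ↭ pedges ends p → weight ends w o ≡ weight ends w p
    weight-↭ o↭p = product-↭ (Perm.map⁺ w o↭p)

    AgreeOff : List (Fin n) → Cfg → Cfg → Set
    AgreeOff xs C C′ = ∀ x → x ∉ xs → C′ x ≡ C x

    move-across : ∀ {e a b} → Joins ends e a b → a ≢ b → ∀ C → w e ≤ C b →
      ∃ λ C′ → Step ends w C C′ × C′ a ≡ suc (C a) × C′ b ≡ C b ∸ w e × AgreeOff (a ∷ b ∷ []) C C′
    move-across {e} j a≢b C w≤C with orientation j
      where
        orientation : ∀ {a b} → Joins ends e a b → ∃ λ d → src ends w e d ≡ b × dst ends w e d ≡ a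
        orientation (inj₁ eq) = false , cong proj₂ eq , cong proj₁ eq
        orientation (inj₂ eq) = true , cong proj₁ eq , cong proj₂ eq
    ... | d , refl , refl = applyMove ends w C e d , move e d w≤C , at-dst , at-src , elsewhere
      where
        s = src ends w e d
        t = dst ends w e d
        at-dst : applyMove ends w C e d t ≡ suc (C t)
        at-dst rewrite dec-false (t ≟ s) a≢b | dec-true (t ≟ t) refl = +-comm (C t) 1
        at-src : applyMove ends w C e d s ≡ C s ∸ w e
        at-src rewrite dec-true (s ≟ s) refl | dec-false (s ≟ t) (a≢b ∘ sym) = +-identityʳ _
        elsewhere : AgreeOff (t ∷ s ∷ []) C (applyMove ends w C e d)
        elsewhere x x∉ rewrite dec-false (x ≟ s) (x∉ ∘ there ∘ here) | dec-false (x ≟ t) (x∉ ∘ here) = +-identityʳ _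

    move-across-many : ∀ {e a b} → Joins ends e a b → a ≢ b → ∀ Q C → Q * w e ≤ C b →
      ∃ λ C′ → Reaches ends w C C′ × C′ a ≡ C a + Q × AgreeOff (a ∷ b ∷ []) C C′
    move-across-many j a≢b zero    C _ = C , ε , sym (+-identityʳ _) , λ _ _ → refl
    move-across-many {e} {a} {b} j a≢b (suc Q) C Q+1≤C
      with C₁ , first , a₁ , b₁ , off₁ ← move-across j a≢b C (≤-trans (m≤m+n (w e) _) Q+1≤C)
      with C₂ , rest , a₂ , off₂ ← move-across-many j a≢b Q C₁
             (subst (Q * w e ≤_) (sym b₁) (m+n≤o⇒m≤o∸n (Q * w e) (subst (_≤ C b) (+-comm (w e) _) Q+1≤C)))
      = C₂ , first ◅ rest , trans a₂ (trans (cong (_+ Q) a₁) (sym (+-suc (C a) Q))) ,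
        λ x x∉ → trans (off₂ x x∉) (off₁ x x∉)

    Coeffs : Set
    Coeffs = List (Fin n × ℕ)

    weighted : Cfg → Fin n × ℕ → ℕ
    weighted C (x , c) = C x * c

    potential : Coeffs → Cfg → ℕ
    potential L C = sum (map (weighted C) L)

    potential-++ : ∀ L K C → potential (L ++ K) C ≡ potential L C + potential K C
    potential-++ L K C = trans (cong sum (map-++ (weighted C) L K)) (sum-++ (map (weighted C) L) _)

    potential-↭ : ∀ {L K} C → L ↭ K → potential L C ≡ potential K C
    potential-↭ C L↭K = sum-↭ (Perm.map⁺ _ L↭K)

    potential-mono : ∀ L {C C′} → (∀ {x c} → (x , c) ∈ L → C x ≤ C′ x) → potential L C ≤ potential L C′
    potential-mono []            _  = z≤n
    potential-mono ((x , c) ∷ L) le = +-mono-≤ (*-monoˡ-≤ c (le (here refl))) (potential-mono L (le ∘ there))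

    potential-gain : ∀ {L C C′ y c D} → (y , c) ∈ L → C′ y ≡ C y + D → (∀ {x c} → (x , c) ∈ L → C x ≤ C′ x) →
                     potential L C + D * c ≤ potential L C′
    potential-gain {(y , c) ∷ L} {C} {C′} {D = D} (here refl) gained le = begin
      C y * c + potential L C + D * c  ≡⟨ xy∙z≈xz∙y (C y * c) _ _ ⟩
      C y * c + D * c + potential L C  ≡⟨ cong (_+ potential L C) (sym (*-distribʳ-+ c (C y) D)) ⟩
      (C y + D) * c + potential L C    ≡⟨ cong (λ k → k * c + potential L C) (sym gained) ⟩
      C′ y * c + potential L C         ≤⟨ +-monoʳ-≤ (C′ y * c) (potential-mono L (le ∘ there)) ⟩
      C′ y * c + potential L C′        ∎
      where open ≤-Reasoning
    potential-gain {(x , c) ∷ L} {C} {C′} {c = c′} {D = D} (there y∈) gained le = begin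
      C x * c + potential L C + D * c′   ≡⟨ +-assoc (C x * c) _ _ ⟩
      C x * c + (potential L C + D * c′) ≤⟨ +-mono-≤ (*-monoˡ-≤ c (le (here refl))) (potential-gain y∈ gained (le ∘ there)) ⟩
      C′ x * c + potential L C′          ∎
      where open ≤-Reasoning

    pathCoeffs : Steps → Coeffs
    pathCoeffs []            = []
    pathCoeffs ((_ , b) ∷ s) = (b , stepsWeight s) ∷ pathCoeffs s

    -- Move pebbles from the far end of s towards y; at each vertex only a remainder
    -- smaller than the next edge weight is left behind.
    collapse : ∀ y s → ValidSteps ends y s → Unique (y ∷ map proj₂ s) → ∀ C →
      ∃₂ λ C′ D → Reaches ends w C C′ × C′ y ≡ C y + D × AgreeOff (y ∷ map proj₂ s) C C′
                × potential (pathCoeffs s) C < suc D * stepsWeight s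
    collapse y [] _ _ C = C , 0 , ε , sym (+-identityʳ _) , (λ _ _ → refl) , s≤s z≤n
    collapse y ((e , y₁) ∷ s) (j , valid) (y∉ ∷ unique) C
      with C₁ , D₁ , reach₁ , y₁-gain , off₁ , bound₁ ← collapse y₁ s valid unique C
      with C₂ , reach₂ , y-gain , off₂ ← move-across-many j (All.head y∉) (C₁ y₁ / w e) C₁ (m/n*n≤m (C₁ y₁) (w e))
      = C₂ , C₁ y₁ / w e , reach₁ ◅◅ reach₂ ,
        trans y-gain (cong (_+ C₁ y₁ / w e) (off₁ y (All.All¬⇒¬Any y∉))) ,
        (λ x x∉ → trans (off₂ x (x∉ ∘ xs⊆xs++ys (y ∷ y₁ ∷ []) (map proj₂ s))) (off₁ x (x∉ ∘ there))) ,
        bound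
      where
        T = stepsWeight s
        Q = C₁ y₁ / w e
        bound : C y₁ * T + potential (pathCoeffs s) C < suc Q * (w e * T)
        bound = begin-strict
          C y₁ * T + potential (pathCoeffs s) C <⟨ +-monoʳ-< (C y₁ * T) bound₁ ⟩
          C y₁ * T + suc D₁ * T                 ≡⟨ sym (*-distribʳ-+ T (C y₁) (suc D₁)) ⟩
          (C y₁ + suc D₁) * T                   ≡⟨ cong (_* T) (trans (+-suc (C y₁) D₁) (cong suc (sym y₁-gain))) ⟩
          suc (C₁ y₁) * T                       ≤⟨ *-monoˡ-≤ T (m<[1+m/n]*n (C₁ y₁) (w e)) ⟩
          suc Q * w e * T                       ≡⟨ *-assoc (suc Q) (w e) T ⟩
          suc Q * (w e * T)                     ∎
          where open ≤-Reasoning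

    ∈-pathCoeffs⁻ : ∀ s {x c} → (x , c) ∈ pathCoeffs s → x ∈ map proj₂ s
    ∈-pathCoeffs⁻ (_ ∷ s) (here refl) = here refl
    ∈-pathCoeffs⁻ (_ ∷ s) (there i)   = there (∈-pathCoeffs⁻ s i)

    ∈-pathCoeffs⁺ : ∀ a s {x} → x ∈ map proj₂ s →
      ∃₂ λ s₁ s₂ → s ≡ s₁ ++ s₂ × lastV ends a s₁ ≡ x × (x , stepsWeight s₂) ∈ pathCoeffs s
    ∈-pathCoeffs⁺ a ((e , b) ∷ s) (here refl) = [ (e , b) ] , s , refl , refl , here refl
    ∈-pathCoeffs⁺ a ((e , b) ∷ s) (there i)
      with s₁ , s₂ , refl , end , x∈ ← ∈-pathCoeffs⁺ b s i
      = (e , b) ∷ s₁ , s₂ , refl , end , there x∈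

    Covers : Coeffs → Set
    Covers L = ∀ x → ∃ λ c → (x , c) ∈ L × 1 ≤ c

    size≡sum-tabulate : ∀ {k} (C : Fin k → ℕ) → size ends w C ≡ sum (tabulate C)
    size≡sum-tabulate {zero}  C = refl
    size≡sum-tabulate {suc k} C = cong (C Fin.zero +_) (size≡sum-tabulate (C ∘ Fin.suc))

    sum≤potential : ∀ U L C → Unique U → (∀ {x} → x ∈ U → ∃ λ c → (x , c) ∈ L × 1 ≤ c) →
                    sum (map C U) ≤ potential L C
    sum≤potential []      L C _             _      = z≤n
    sum≤potential (x ∷ U) L C (x∉U ∷ uniq) listed
      with c , xc∈L , c≥1 ← listed (here refl)
      with L₁ , L₂ , refl ← ∈-∃++ xc∈L = begin
        C x + sum (map C U)                   ≤⟨ +-mono-≤ (m≤m*n (C x) c {{>-nonZero c≥1}}) (sum≤potential U (L₁ ++ L₂) C uniq listed′) ⟩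
        C x * c + potential (L₁ ++ L₂) C      ≡⟨ potential-↭ C (↭-sym (Perm.shift (x , c) L₁ L₂)) ⟩
        potential (L₁ ++ (x , c) ∷ L₂) C      ∎
      where
        open ≤-Reasoning
        listed′ : ∀ {y} → y ∈ U → ∃ λ c → (y , c) ∈ L₁ ++ L₂ × 1 ≤ c
        listed′ y∈U with c′ , yc′∈L , c′≥1 ← listed (there y∈U)
          with ∈-resp-↭ (Perm.shift (x , c) L₁ L₂) yc′∈L
        ... | here y≡x  = ⊥-elim (All.lookup x∉U y∈U (sym (cong proj₁ y≡x)))
        ... | there y∈L = c′ , y∈L , c′≥1

    size≤potential : ∀ {L} → Covers L → ∀ C → size ends w C ≤ potential L C
    size≤potential {L} covers C = begin
      size ends w C            ≡⟨ size≡sum-tabulate C ⟩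
      sum (tabulate C)         ≡⟨ cong sum (map-tabulate id C) ⟨
      sum (map C (allFin n))   ≤⟨ sum≤potential (allFin n) L C (Unique.tabulate⁺ id) (λ {x} _ → covers x) ⟩
      potential L C            ∎
      where open ≤-Reasoning

    module _ (r : Fin n) where

      treeVerts-++⁺ˡ : ∀ prev ps {x} → x ∈ treeVerts ends r prev → x ∈ treeVerts ends r (prev ++ ps)
      treeVerts-++⁺ˡ prev ps (here x≡r) = here x≡r
      treeVerts-++⁺ˡ prev ps (there x∈) = there (∈-concatMap-++⁺ˡ (pverts ends) prev ps x∈)

      treeVerts-∷ʳ⁺ʳ : ∀ prev p {x} → x ∈ pverts ends p → x ∈ treeVerts ends r (prev ++ [ p ])
      treeVerts-∷ʳ⁺ʳ prev p x∈p = there (∈-concatMap-++⁺ʳ (pverts ends) prev (∈-++⁺ˡ x∈p))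

      treeVerts-∷ʳ⁻ : ∀ prev p {x} → x ∈ treeVerts ends r (prev ++ [ p ]) → x ∈ treeVerts ends r prev ⊎ x ∈ pverts ends p
      treeVerts-∷ʳ⁻ prev p (here x≡r) = inj₁ (here x≡r)
      treeVerts-∷ʳ⁻ prev p (there x∈) with ∈-concatMap-++⁻ (pverts ends) prev x∈
      ... | inj₁ x∈prev = inj₁ (there x∈prev)
      ... | inj₂ x∈p++[] with ∈-++⁻ (pverts ends p) x∈p++[]
      ...   | inj₁ x∈p = inj₂ x∈p

      tree-spans : ∀ prev → (∀ e → e ∈ usedEdges ends prev) → (∀ x → Star (Adj ends) r x) →
                   ∀ x → x ∈ treeVerts ends r prev
      tree-spans prev all-used connected x = reach (connected x) (here refl)
        where
          reach : ∀ {a y} → Star (Adj ends) a y → a ∈ treeVerts ends r prev → y ∈ treeVerts ends r prev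
          reach ε                a∈ = a∈
          reach ((e , joins) ◅ rest) _
            with p , p∈prev , e∈p ← find (∈-concatMap⁻ (pedges ends) {prev} (all-used e))
            = reach rest (there (∈-concatMap⁺ (pverts ends) {prev}
                (lose p∈prev (edge-endpoint-on-steps (start p) (steps p) (valid p) e∈p joins))))

      record Pendant (prev : List (Path ends)) (x : Fin n) (q : Path ends) : Set where
        constructor pendant
        field
          starts-at      : start q ≡ x
          fresh-edges    : All (_∉ usedEdges ends prev) (pedges ends q)
          fresh-vertices : Disjoint (map proj₂ (steps q)) (treeVerts ends r prev)

      pendant-∷ʳ⁻ : ∀ prev p {x q} → Pendant (prev ++ [ p ]) x q → Pendant prev x q
      pendant-∷ʳ⁻ prev p (pendant q-start q-unused q-fresh) =
        pendant q-start (All.map (_∘ ∈-concatMap-++⁺ˡ (pedges ends) prev [ p ]) q-unused)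
          λ (y∈q , y∈tree) → q-fresh (y∈q , treeVerts-++⁺ˡ prev [ p ] y∈tree)

      pendant⇒candidate : ∀ prev {x q} → Pendant prev x q → x ∈ treeVerts ends r prev → Candidate ends r prev q
      pendant⇒candidate prev {x} {q} (pendant q-start q-unused q-fresh) x∈tree =
        q-unused , x , inj₁ (sym q-start) , x∈tree , only-x
        where
          only-x : ∀ y → y ∈ pverts ends q → y ∈ treeVerts ends r prev → y ≡ x
          only-x y (here y≡start) _      = trans y≡start q-start
          only-x y (there y∈q)    y∈tree = ⊥-elim (q-fresh (y∈q , y∈tree))

      record Admissible (prev : List (Path ends)) (L : Coeffs) : Set where
        field
          supported : ∀ {x c} → (x , c) ∈ L → x ∈ treeVerts ends r prev
          dominates : ∀ {x} → x ∈ treeVerts ends r prev →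
                      ∃ λ c → (x , c) ∈ L × 1 ≤ c × (∀ q → Pendant prev x q → weight ends w q ≤ c)

      first-is-heaviest : ∀ {Ps q qs} → RMaxPartition ends w r Ps → (q ∷ qs) ↭ Ps →
                          Linked (λ a b → b ≤ a) (map (weight ends w) (q ∷ qs)) →
                          ∀ q′ → Candidate ends r [] q′ → weight ends w q′ ≤ weight ends w q
      first-is-heaviest {[]}     _                   q∷qs↭[] _      = ⊥-elim (¬x∷xs↭[] q∷qs↭[])
      first-is-heaviest {P ∷ Ps} (step _ heaviest _) q∷qs↭Ps sorted q′ cand =
        ≤-trans (heaviest q′ cand)
          (All.lookup (Linked⇒All (λ a≥b b≥c → ≤-trans b≥c a≥b) ≤-refl sorted)
            (∈-map⁺ (weight ends w) (∈-resp-↭ (↭-sym q∷qs↭Ps) (here refl))))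

      module Absorb {prev : List (Path ends)} {p : Path ends} {v : Fin n}
                    (unused : All (_∉ usedEdges ends prev) (pedges ends p))
                    (v-end : v ≡ start p ⊎ v ≡ pend ends p)
                    (v∈tree : v ∈ treeVerts ends r prev)
                    (only-v : ∀ x → x ∈ pverts ends p → x ∈ treeVerts ends r prev → x ≡ v) where

        open Orientation (orientFrom p v-end) renaming (path to o)

        y : Fin n
        y = start o

        s : Steps
        s = steps o

        y∈tree : y ∈ treeVerts ends r prev
        y∈tree = subst (_∈ treeVerts ends r prev) (sym starts-at) v∈tree

        on-p : ∀ {x} → x ∈ pverts ends o → x ∈ pverts ends p
        on-p = ∈-resp-↭ vertices-↭

        s-fresh : Disjoint (map proj₂ s) (treeVerts ends r prev)
        s-fresh (x∈s , x∈tree) =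
          All.lookup (AllPairs.head (distinct o)) x∈s (sym (trans (only-v _ (on-p (there x∈s)) x∈tree) (sym starts-at)))

        o-pendant : Pendant prev y o
        o-pendant = pendant refl (All.tabulate (All.lookup unused ∘ ∈-resp-↭ edges-↭)) s-fresh

        o-weight : weight ends w o ≡ weight ends w p
        o-weight = weight-↭ {o} {p} edges-↭

        K : Coeffs
        K = pathCoeffs s

        transfer : ∀ {L} → Admissible prev L → ∀ C →
                   ∃ λ C′ → Reaches ends w C C′ × potential (L ++ K) C < potential L C′ + weight ends w p
        transfer {L} adm C
          with C′ , D , reach , y-gain , off , bound ← collapse y s (valid o) (distinct o) C
          with c , yc∈L , _ , dominated ← Admissible.dominates adm y∈tree
          = C′ , reach , (begin-strict
              potential (L ++ K) C                ≡⟨ potential-++ L K C ⟩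
              potential L C + potential K C       <⟨ +-monoʳ-< (potential L C) bound ⟩
              potential L C + suc D * Wo          ≡⟨ cong (λ t → potential L C + suc D * t) o-weight ⟩
              potential L C + (Wp + D * Wp)       ≡⟨ x∙yz≈xz∙y (potential L C) Wp (D * Wp) ⟩
              potential L C + D * Wp + Wp         ≤⟨ +-monoˡ-≤ Wp gain ⟩
              potential L C′ + Wp                 ∎)
          where
            open ≤-Reasoning
            Wo = weight ends w o
            Wp = weight ends w p
            unchanged : ∀ {x c} → (x , c) ∈ L → C x ≤ C′ x
            unchanged {x} xc∈L with x ≟ y
            ... | yes refl = subst (C y ≤_) (sym y-gain) (m≤m+n (C y) D)
            ... | no x≢y = ≤-reflexive (sym (off x λ
                  { (here x≡y) → x≢y x≡y
                  ; (there x∈s) → s-fresh (x∈s , Admissible.supported adm xc∈L) }))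
            gain : potential L C + D * Wp ≤ potential L C′
            gain = ≤-trans (+-monoʳ-≤ (potential L C) (*-monoʳ-≤ D (subst (_≤ c) o-weight (dominated o o-pendant))))
                           (potential-gain yc∈L y-gain unchanged)

        graft-pendant : ∀ s₁ s₂ → s ≡ s₁ ++ s₂ → ∀ q → Pendant (prev ++ [ p ]) (lastV ends y s₁) q →
                        ∃ λ q′ → Pendant prev y q′ × weight ends w q′ ≡ stepsWeight s₁ * weight ends w q
        graft-pendant s₁ s₂ s≡ q q-pendant@(pendant q-start _ q-fresh) =
          graft y s₁ q valid₁ unique₁ q-start disjoint , pendant refl unused′ fresh′ , stepsWeight-++ s₁ (steps q)
          where
            vertices≡ : map proj₂ s ≡ map proj₂ s₁ ++ map proj₂ s₂
            vertices≡ = trans (cong (map proj₂) s≡) (map-++ proj₂ s₁ s₂)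
            edges≡ : map proj₁ s ≡ map proj₁ s₁ ++ map proj₁ s₂
            edges≡ = trans (cong (map proj₁) s≡) (map-++ proj₁ s₁ s₂)
            on-s : ∀ {x} → x ∈ map proj₂ s₁ → x ∈ map proj₂ s
            on-s = subst (_ ∈_) (sym vertices≡) ∘ ∈-++⁺ˡ
            valid₁ : ValidSteps ends y s₁
            valid₁ = ValidSteps-++⁻ˡ y s₁ s₂ (subst (ValidSteps ends y) s≡ (valid o))
            unique₁ : Unique (y ∷ map proj₂ s₁)
            unique₁ = Unique-++⁻ˡ (y ∷ map proj₂ s₁) (subst (λ l → Unique (y ∷ l)) vertices≡ (distinct o))
            disjoint : Disjoint (y ∷ map proj₂ s₁) (map proj₂ (steps q))
            disjoint (here x≡y , x∈q)   = q-fresh (x∈q , treeVerts-++⁺ˡ prev [ p ] (subst (_∈ _) (sym x≡y) y∈tree))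
            disjoint (there x∈s₁ , x∈q) = q-fresh (x∈q , treeVerts-∷ʳ⁺ʳ prev p (on-p (there (on-s x∈s₁))))
            unused′ : All (_∉ usedEdges ends prev) (map proj₁ (s₁ ++ steps q))
            unused′ = subst (All _) (sym (map-++ proj₁ s₁ (steps q)))
              (All.++⁺ (All.++⁻ˡ (map proj₁ s₁) (subst (All _) edges≡ (Pendant.fresh-edges o-pendant)))
                       (Pendant.fresh-edges (pendant-∷ʳ⁻ prev p q-pendant)))
            fresh′ : Disjoint (map proj₂ (s₁ ++ steps q)) (treeVerts ends r prev)
            fresh′ (x∈ , x∈tree) with ∈-++⁻ (map proj₂ s₁) (subst (_ ∈_) (map-++ proj₂ s₁ (steps q)) x∈)
            ... | inj₁ x∈s₁ = s-fresh (on-s x∈s₁ , x∈tree)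
            ... | inj₂ x∈q  = q-fresh (x∈q , treeVerts-++⁺ˡ prev [ p ] x∈tree)

        admissible : (∀ q → Candidate ends r prev q → weight ends w q ≤ weight ends w p) →
                     ∀ {L} → Admissible prev L → Admissible (prev ++ [ p ]) (L ++ K)
        admissible heaviest {L} adm = record { supported = supported′ ; dominates = dominates′ }
          where
            open Admissible adm
            supported′ : ∀ {x c} → (x , c) ∈ L ++ K → x ∈ treeVerts ends r (prev ++ [ p ])
            supported′ xc∈ with ∈-++⁻ L xc∈
            ... | inj₁ xc∈L = treeVerts-++⁺ˡ prev [ p ] (supported xc∈L)
            ... | inj₂ xc∈K = treeVerts-∷ʳ⁺ʳ prev p (on-p (there (∈-pathCoeffs⁻ s xc∈K)))
            old : ∀ {x} → x ∈ treeVerts ends r prev → ∃ λ c → (x , c) ∈ L ++ K × 1 ≤ c ×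
                  (∀ q → Pendant (prev ++ [ p ]) x q → weight ends w q ≤ c)
            old x∈tree with c , xc∈L , c≥1 , dominated ← dominates x∈tree =
              c , ∈-++⁺ˡ xc∈L , c≥1 , λ q → dominated q ∘ pendant-∷ʳ⁻ prev p
            new : ∀ s₁ s₂ → s ≡ s₁ ++ s₂ → ∀ q → Pendant (prev ++ [ p ]) (lastV ends y s₁) q →
                  weight ends w q ≤ stepsWeight s₂
            new s₁ s₂ s≡ q q-pendant with q′ , q′-pendant , q′-weight ← graft-pendant s₁ s₂ s≡ q q-pendant =
              *-cancelˡ-≤ (stepsWeight s₁) {{>-nonZero (stepsWeight≥1 s₁)}} (begin
                stepsWeight s₁ * weight ends w q  ≡⟨ q′-weight ⟨
                weight ends w q′                  ≤⟨ heaviest q′ (pendant⇒candidate prev q′-pendant y∈tree) ⟩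
                weight ends w p                   ≡⟨ o-weight ⟨
                stepsWeight s                     ≡⟨ cong stepsWeight s≡ ⟩
                stepsWeight (s₁ ++ s₂)            ≡⟨ stepsWeight-++ s₁ s₂ ⟩
                stepsWeight s₁ * stepsWeight s₂   ∎)
              where open ≤-Reasoning
            dominates′ : ∀ {x} → x ∈ treeVerts ends r (prev ++ [ p ]) → ∃ λ c → (x , c) ∈ L ++ K × 1 ≤ c ×
                         (∀ q → Pendant (prev ++ [ p ]) x q → weight ends w q ≤ c)
            dominates′ x∈tree with treeVerts-∷ʳ⁻ prev p x∈tree
            ... | inj₁ x∈old = old x∈old
            ... | inj₂ x∈p with ∈-resp-↭ (↭-sym vertices-↭) x∈p
            ...   | here refl = old y∈tree
            ...   | there x∈s with s₁ , s₂ , s≡ , refl , x∈K ← ∈-pathCoeffs⁺ y s x∈s =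
                    stepsWeight s₂ , ∈-++⁺ʳ L x∈K , stepsWeight≥1 s₂ , new s₁ s₂ s≡

      admissible-root : ∀ A → 1 ≤ A → (∀ q → Candidate ends r [] q → weight ends w q ≤ A) → Admissible [] [ (r , A) ]
      admissible-root A A≥1 A-bounds = record
        { supported = λ { (here refl) → here refl }
        ; dominates = λ { (here refl) → A , here refl , A≥1 ,
                            λ q q-pendant → A-bounds q (pendant⇒candidate [] q-pendant (here refl)) } }

      module _ (connected : ∀ x → Star (Adj ends) r x) where

        absorb-partition : ∀ {prev ps} → MaxPartFrom ends w r prev ps → ∀ {L} → Admissible prev L →
          ∃ λ Lf → Covers Lf × (∀ C → ∃ λ C′ → Reaches ends w C C′ ×
            potential Lf C + length ps ≤ potential L C′ + sum (map (weight ends w) ps))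
        absorb-partition {prev} (done all-used) {L} adm = L , covers , λ C → C , ε , ≤-refl
          where
            covers : Covers L
            covers x with c , xc∈L , c≥1 , _ ← Admissible.dominates adm (tree-spans prev all-used connected x) =
              c , xc∈L , c≥1
        absorb-partition {prev} {p ∷ ps} (step (unused , v , v-end , v∈tree , only-v) heaviest rest) {L} adm =
          let Lf , covers , transfer-rest = absorb-partition rest (Attach.admissible heaviest adm) in
          Lf , covers , λ C →
            let C₁ , reach₁ , ineq₁ = transfer-rest C
                C₂ , reach₂ , ineq₂ = Attach.transfer adm C₁
            in C₂ , reach₁ ◅◅ reach₂ , (begin
              potential Lf C + suc (length ps)          ≡⟨ +-suc (potential Lf C) (length ps) ⟩
              suc (potential Lf C + length ps)          ≤⟨ s≤s ineq₁ ⟩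
              suc (potential (L ++ Attach.K) C₁ + Σps)  ≤⟨ +-monoˡ-≤ Σps ineq₂ ⟩
              potential L C₂ + weight ends w p + Σps    ≡⟨ +-assoc (potential L C₂) _ Σps ⟩
              potential L C₂ + (weight ends w p + Σps)  ∎)
          where
            module Attach = Absorb {prev} {p} unused v-end v∈tree only-v
            open ≤-Reasoning
            Σps = sum (map (weight ends w) ps)

        pebbling-inequality : ∀ {Ps} → RMaxPartition ends w r Ps → ∀ A → 1 ≤ A →
          (∀ q → Candidate ends r [] q → weight ends w q ≤ A) →
          ∀ C → ∃ λ C′ → Reaches ends w C C′ × size ends w C + length Ps ≤ C′ r * A + sum (map (weight ends w) Ps)
        pebbling-inequality {Ps} partition A A≥1 A-bounds C
          with Lf , covers , transfer ← absorb-partition partition (admissible-root A A≥1 A-bounds)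
          with C′ , reach , ineq ← transfer C
          = C′ , reach , (begin
              size ends w C + length Ps      ≤⟨ +-monoˡ-≤ (length Ps) (size≤potential covers C) ⟩
              potential Lf C + length Ps     ≤⟨ ineq ⟩
              C′ r * A + 0 + ΣPs             ≡⟨ cong (_+ ΣPs) (+-identityʳ (C′ r * A)) ⟩
              C′ r * A + ΣPs                 ∎)
          where
            open ≤-Reasoning
            ΣPs = sum (map (weight ends w) Ps)

theorem6 : ∀ {n m : ℕ} (ends : Fin m → Fin n × Fin n) (w : Fin m → ℕ) (r : Fin n)
         → IsTree ends
         → (∀ e → 1 ≤ w e)
         → (Ps : List (Path ends)) → RMaxPartition ends w r Ps
         → (q : Path ends) (qs : List (Path ends)) → (q ∷ qs) ↭ Ps
         → Linked (λ a b → b ≤ a) (map (weight ends w) (q ∷ qs))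
         → (k : ℕ) → 1 ≤ k
         → PebblingBoundLE ends w k r (fkw ends w k q qs)
-- The bound holds for k = 0 as well.
theorem6 ends w r (_ , connected) w≥1 Ps partition q qs q∷qs↭Ps sorted k _ =
  fkw ends w k q qs , ≤-refl , solvable
  where
    A = weight ends w q
    S = sum (map (weight ends w) qs)
    t = length (q ∷ qs)
    solvable : ∀ C → size ends w C ≡ fkw ends w k q qs → Solvable ends w k r C
    solvable C size≡f
      with C′ , reach , ineq ← pebbling-inequality ends w w≥1 r (connected r) partition A
             (stepsWeight≥1 ends w w≥1 (Path.steps q)) (first-is-heaviest ends w w≥1 r partition q∷qs↭Ps sorted) C
      = C′ , reach , m*a+s<[1+n]*a+s⇒m≤n k (C′ r) A S (begin-strict
          k * A + S                                <⟨ n<1+n (k * A + S) ⟩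
          suc (k * A + S)                          ≡⟨ +-comm 1 (k * A + S) ⟩
          k * A + S + 1                            ≤⟨ m≤n+m∸n (k * A + S + 1) t ⟩
          t + fkw ends w k q qs                    ≡⟨ +-comm t _ ⟩
          fkw ends w k q qs + t                    ≡⟨ cong₂ _+_ (sym size≡f) (↭-length q∷qs↭Ps) ⟩
          size ends w C + length Ps                ≤⟨ ineq ⟩
          C′ r * A + sum (map (weight ends w) Ps)  ≡⟨ cong (C′ r * A +_) (sum-↭ (Perm.map⁺ (weight ends w) (↭-sym q∷qs↭Ps))) ⟩
          C′ r * A + (A + S)                       ≡⟨ x∙yz≈yx∙z (C′ r * A) A S ⟩
          suc (C′ r) * A + S                       ∎)
      where open ≤-Reasoning
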